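{- Let $S=\{s_1<\dots<s_n\}\subset\mathbb{N}$ with $n\ge 2$. If $S$ has symmetry type $(2,n)$, then there exists a rational $k>1$ such that $C_2(n,k)=\{0,1,k,k^2,\dots,k^{n-2}\}$ is a copy of $S$. If $S$ has symmetry type $(1,n-1)$, then there exists a rational $k>1$ such that $C_2(n,k)$ is a reflection of $S$.
   Context: For $R,R'\subset\mathbb{Q}$, $R'$ is a copy of $R$ if $R'=aR+b$ for some rational $a>0$ and rational $b$; $R'$ is a reflection of $R$ if $R'=aR+b$ for some rational $a<0$ and rational $b$. $S$ has symmetry type $(i,j)$ (with $1\le i<j\le n$) if $S\setminus\{s_i\}$ is a copy of $S\setminus\{s_j\}$. -}

module Defs where

open import Data.Nat using (ℕ; zero; suc; _≤_)
open import Data.Integer using (+_)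
open import Data.Fin using (Fin; toℕ) renaming (_<_ to _<ᶠ_)
open import Data.Rational using (ℚ; _/_; _+_; _*_; _<_; 0ℚ; 1ℚ)
open import Data.Product using (Σ; _×_; ∃)
open import Data.Sum using (_⊎_)
open import Relation.Binary.PropositionalEquality using (_≡_; _≢_)
open import Function.Bundles using (_⇔_)

SubQ : Set₁
SubQ = ℚ → Set

ℕ→ℚ : ℕ → ℚ
ℕ→ℚ n = (+ n) / 1

_^_ : ℚ → ℕ → ℚ
k ^ zero  = 1ℚ
k ^ suc e = k * (k ^ e)

_≐_ : SubQ → SubQ → Set
A ≐ B = ∀ x → A x ⇔ B x

affImg : ℚ → ℚ → SubQ → SubQ
affImg a b R x = ∃ λ y → R y × x ≡ a * y + b

IsCopy : SubQ → SubQ → Set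
IsCopy R' R = Σ ℚ λ a → Σ ℚ λ b → (0ℚ < a) × (R' ≐ affImg a b R)

IsReflection : SubQ → SubQ → Set
IsReflection R' R = Σ ℚ λ a → Σ ℚ λ b → (a < 0ℚ) × (R' ≐ affImg a b R)

StrictlyIncreasing : {n : ℕ} → (Fin n → ℕ) → Set
StrictlyIncreasing {n} s = ∀ (i j : Fin n) → i <ᶠ j → Data.Nat._<_ (s i) (s j)

setOf : {n : ℕ} → (Fin n → ℕ) → SubQ
setOf {n} s x = ∃ λ (l : Fin n) → x ≡ ℕ→ℚ (s l)

-- S \ {s_i}  (values are distinct since s is strictly increasing)
removeAt : {n : ℕ} → (Fin n → ℕ) → Fin n → SubQ
removeAt {n} s i x = ∃ λ (l : Fin n) → (l ≢ i) × (x ≡ ℕ→ℚ (s l))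

-- S has symmetry type (i,j), i < j (0-based indices here; paper is 1-based)
HasSymType : {n : ℕ} → (Fin n → ℕ) → Fin n → Fin n → Set
HasSymType s i j = (i <ᶠ j) × IsCopy (removeAt s i) (removeAt s j)

-- C_2(n,k) = {0, 1, k, k^2, ..., k^(n-2)}, for n = m + 2
C₂ : (m : ℕ) → ℚ → SubQ
C₂ m k x = (x ≡ 0ℚ) ⊎ (∃ λ (e : ℕ) → (e ≤ m) × (x ≡ k ^ e))

-- An affine map of positive slope preserves order, and two increasing enumerations of the same
-- finite set coincide.  So S ∖ {s₂} = a (S ∖ {sₙ}) + b means s₁ = a s₁ + b and s_{j+1} = a s_j + b
-- for 2 ≤ j < n; subtracting, the gaps s_{j+1} − s₁ form a geometric progression of ratio a, and
-- a > 1 because the gaps increase.  Dividing by s₂ − s₁ turns S into C₂(n, a).  The reflection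
-- case is the copy case for −S, on which the symmetry type (1, n−1) of S becomes (2, n).
module Submission where

open import Defs
open import Data.Nat using (ℕ; suc)
open import Data.Fin using (Fin; zero; suc; fromℕ; inject₁)
open import Data.Rational using (ℚ; 1ℚ; _<_)
open import Data.Product using (Σ; _×_)

import Data.Nat as ℕ
import Data.Nat.Properties as ℕ
import Data.Integer as ℤ
import Data.Integer.Properties as ℤ
open import Data.Nat.Coprimality using (1-coprimeTo)
import Data.Nat.Coprimality as Coprimality
open import Data.Fin using (toℕ; opposite; punchIn; punchOut; fromℕ<) renaming (_<_ to _<ᶠ_)
import Data.Fin.Properties as Fin
open import Data.Rational
  using (mkℚ; _+_; _*_; _-_; -_; 0ℚ; _≤_; 1/_; Positive; NonZero; positive; *<*)
import Data.Rational.Properties as ℚ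
open import Data.Rational.Solver using (module +-*-Solver)
open import Data.Product using (_,_; ∃)
open import Data.Sum using (inj₁; inj₂)
open import Data.Empty using (⊥-elim)
open import Function.Base using (_∘_)
open import Function.Bundles using (Equivalence; mk⇔)
import Function.Properties.Equivalence as ⇔
open import Level using (0ℓ) renaming (suc to lsuc)
open import Relation.Binary.Bundles using (Setoid)
import Relation.Binary.Reasoning.Setoid as SetoidReasoning
open import Relation.Unary using (_⊆_)
open import Relation.Binary.PropositionalEquality

open +-*-Solver

private variable
  n : ℕ
  A A′ B B′ R R′ : SubQ

≐-setoid : Setoid (lsuc 0ℓ) 0ℓ
≐-setoid = record
  { Carrier       = SubQ
  ; _≈_           = _≐_
  ; isEquivalence = record
    { refl  = λ _ → ⇔.refl
    ; sym   = λ A≐B x → ⇔.sym (A≐B x)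
    ; trans = λ A≐B B≐C x → ⇔.trans (A≐B x) (B≐C x)
    }
  }

open Setoid ≐-setoid using () renaming (refl to ≐-refl; sym to ≐-sym; trans to ≐-trans)
module ≐-Reasoning = SetoidReasoning ≐-setoid

≐⇒⊆ : A ≐ B → A ⊆ B
≐⇒⊆ A≐B = Equivalence.to (A≐B _)

≐⇒⊇ : A ≐ B → B ⊆ A
≐⇒⊇ A≐B = Equivalence.from (A≐B _)

affImg-cong : ∀ a b → A ≐ B → affImg a b A ≐ affImg a b B
affImg-cong a b A≐B x = mk⇔
  (λ (y , Ay , x≡) → y , ≐⇒⊆ A≐B Ay , x≡)
  (λ (y , By , x≡) → y , ≐⇒⊇ A≐B By , x≡)

affImg-∘ : ∀ a b c d → affImg a b (affImg c d R) ≐ affImg (a * c) (a * d + b) R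
affImg-∘ a b c d x = mk⇔
  (λ (y , (z , Rz , y≡) , x≡) → z , Rz , trans x≡ (trans (cong (λ t → a * t + b) y≡) (compose z)))
  (λ (z , Rz , x≡) → c * z + d , (z , Rz , refl) , trans x≡ (sym (compose z)))
  where
  compose : ∀ z → a * (c * z + d) + b ≡ a * c * z + (a * d + b)
  compose = solve 5 (λ a b c d z → a :* (c :* z :+ d) :+ b := a :* c :* z :+ (a :* d :+ b))
    refl a b c d

affImg-identity : affImg 1ℚ 0ℚ R ≐ R
affImg-identity {R} x = mk⇔
  (λ (y , Ry , x≡) → subst R (sym (trans x≡ (unit y))) Ry)
  (λ Rx → x , Rx , sym (unit x))
  where
  unit : ∀ y → 1ℚ * y + 0ℚ ≡ y
  unit y = trans (ℚ.+-identityʳ (1ℚ * y)) (ℚ.*-identityˡ y)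

affImg-inverse : ∀ a .{{_ : NonZero a}} b → R ≐ affImg a b R′ →
                 R′ ≐ affImg (1/ a) (- (1/ a * b)) R
affImg-inverse {R} {R′} a b R≐ = begin
  R′                                              ≈⟨ affImg-identity ⟨
  affImg 1ℚ 0ℚ R′                                 ≡⟨ cong₂ (λ p q → affImg p q R′)
                                                       (sym (ℚ.*-inverseˡ a)) (sym (ℚ.+-inverseʳ (1/ a * b))) ⟩
  affImg (1/ a * a) (1/ a * b + - (1/ a * b)) R′  ≈⟨ affImg-∘ (1/ a) (- (1/ a * b)) a b ⟨
  affImg (1/ a) (- (1/ a * b)) (affImg a b R′)    ≈⟨ affImg-cong (1/ a) (- (1/ a * b)) R≐ ⟨
  affImg (1/ a) (- (1/ a * b)) R                  ∎
  where open ≐-Reasoning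

IsCopy-sym : IsCopy A B → IsCopy B A
IsCopy-sym (a , b , 0<a , A≐) =
  1/ a , - (1/ a * b) , ℚ.positive⁻¹ (1/ a) {{ℚ.1/pos⇒pos a}} , affImg-inverse a b A≐
  where
  instance
    a-positive : Positive a
    a-positive = positive 0<a
    a-nonZero : NonZero a
    a-nonZero = ℚ.pos⇒nonZero a

IsCopy-cong : A ≐ A′ → B ≐ B′ → IsCopy A B → IsCopy A′ B′
IsCopy-cong A≐A′ B≐B′ (a , b , 0<a , A≐) =
  a , b , 0<a , ≐-trans (≐-sym A≐A′) (≐-trans A≐ (affImg-cong a b B≐B′))

neg : SubQ → SubQ
neg = affImg (- 1ℚ) 0ℚ

IsCopy-neg : IsCopy A B → IsCopy (neg A) (neg B)
IsCopy-neg {A} {B} (a , b , 0<a , A≐) = a , - b , 0<a , (begin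
  neg A                                ≈⟨ affImg-cong (- 1ℚ) 0ℚ A≐ ⟩
  neg (affImg a b B)                   ≈⟨ affImg-∘ (- 1ℚ) 0ℚ a b ⟩
  affImg (- 1ℚ * a) (- 1ℚ * b + 0ℚ) B  ≡⟨ cong₂ (λ p q → affImg p q B) (ℚ.*-comm (- 1ℚ) a) (shift a b) ⟩
  affImg (a * - 1ℚ) (a * 0ℚ + - b) B   ≈⟨ affImg-∘ a (- b) (- 1ℚ) 0ℚ ⟨
  affImg a (- b) (neg B)               ∎)
  where
  open ≐-Reasoning
  shift : ∀ a b → - 1ℚ * b + 0ℚ ≡ a * 0ℚ + - b
  shift = solve 2 (λ a b → :- con 1ℚ :* b :+ con 0ℚ := a :* con 0ℚ :+ :- b) refl

IsCopy-neg⇒IsReflection : IsCopy A (neg B) → IsReflection A B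
IsCopy-neg⇒IsReflection (a , b , 0<a , A≐) =
  a * - 1ℚ , a * 0ℚ + b , a*-1<0 , ≐-trans A≐ (affImg-∘ a b (- 1ℚ) 0ℚ)
  where
  a*-1<0 : a * - 1ℚ < 0ℚ
  a*-1<0 = subst (a * - 1ℚ <_) (ℚ.*-zeroʳ a)
    (ℚ.*-monoʳ-<-pos a {{positive 0<a}} (ℚ.negative⁻¹ (- 1ℚ)))

Increasing : (Fin n → ℚ) → Set
Increasing {n} v = ∀ (i j : Fin n) → i <ᶠ j → v i < v j

image : (Fin n → ℚ) → SubQ
image v x = ∃ λ l → x ≡ v l

imageWithout : (Fin n → ℚ) → Fin n → SubQ
imageWithout v i x = ∃ λ l → (l ≢ i) × (x ≡ v l)

mirror : (Fin n → ℚ) → Fin n → ℚ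
mirror v l = - v (opposite l)

ℕ→ℚ≡mkℚ : ∀ n → ℕ→ℚ n ≡ mkℚ (ℤ.+ n) 0 (Coprimality.sym (1-coprimeTo n))
ℕ→ℚ≡mkℚ n = ℚ.normalize-coprime (Coprimality.sym (1-coprimeTo n))

ℕ→ℚ-mono-< : ∀ {m n} → m ℕ.< n → ℕ→ℚ m < ℕ→ℚ n
ℕ→ℚ-mono-< {m} {n} m<n rewrite ℕ→ℚ≡mkℚ m | ℕ→ℚ≡mkℚ n =
  *<* (subst₂ ℤ._<_ (sym (ℤ.*-identityʳ (ℤ.+ m))) (sym (ℤ.*-identityʳ (ℤ.+ n))) (ℤ.+<+ m<n))

punchIn-mono-< : ∀ (i : Fin (suc n)) (j k : Fin n) → j <ᶠ k → punchIn i j <ᶠ punchIn i k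
punchIn-mono-< zero    j       k       j<k           = ℕ.s<s j<k
punchIn-mono-< (suc i) zero    (suc k) _             = ℕ.z<s
punchIn-mono-< (suc i) (suc j) (suc k) (ℕ.s<s j<k) = ℕ.s<s (punchIn-mono-< i j k j<k)

opposite-antimono-< : ∀ {i j : Fin n} → i <ᶠ j → opposite j <ᶠ opposite i
opposite-antimono-< {i = i} {j} i<j =
  subst₂ ℕ._<_ (sym (Fin.opposite-prop j)) (sym (Fin.opposite-prop i))
    (ℕ.∸-monoʳ-< (ℕ.s<s i<j) (Fin.toℕ<n j))

punchIn-fromℕ : ∀ (i : Fin n) → punchIn (fromℕ n) i ≡ inject₁ i
punchIn-fromℕ zero    = refl
punchIn-fromℕ (suc i) = cong suc (punchIn-fromℕ i)

increasing-tail : {v : Fin (suc n) → ℚ} → Increasing v → Increasing (v ∘ suc)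
increasing-tail inc i j i<j = inc (suc i) (suc j) (ℕ.s<s i<j)

increasing-punchIn : {v : Fin (suc n) → ℚ} → Increasing v → ∀ i → Increasing (v ∘ punchIn i)
increasing-punchIn inc i j k j<k = inc _ _ (punchIn-mono-< i j k j<k)

increasing-affine : ∀ {a b} {v : Fin n → ℚ} → 0ℚ < a → Increasing v → Increasing (λ l → a * v l + b)
increasing-affine {a = a} {b} 0<a inc i j i<j =
  ℚ.+-monoˡ-< b (ℚ.*-monoʳ-<-pos a {{positive 0<a}} (inc i j i<j))

increasing-mirror : {v : Fin n → ℚ} → Increasing v → Increasing (mirror v)
increasing-mirror inc i j i<j = ℚ.neg-antimono-< (inc _ _ (opposite-antimono-< i<j))

head-≤ : {v : Fin (suc n) → ℚ} → Increasing v → ∀ i → v zero ≤ v i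
head-≤ inc zero    = ℚ.≤-refl
head-≤ inc (suc i) = ℚ.<⇒≤ (inc zero (suc i) ℕ.z<s)

head-≤-of-⊆ : {v w : Fin (suc n) → ℚ} → Increasing w → image v ⊆ image w → w zero ≤ v zero
head-≤-of-⊆ {w = w} inc v⊆w with v⊆w (zero , refl)
... | l , v₀≡wₗ = subst (w zero ≤_) (sym v₀≡wₗ) (head-≤ inc l)

tail-⊆ : {v w : Fin (suc n) → ℚ} → Increasing v → v zero ≡ w zero →
         image v ⊆ image w → image (v ∘ suc) ⊆ image (w ∘ suc)
tail-⊆ inc v₀≡w₀ v⊆w (i , x≡) with v⊆w (suc i , x≡)
... | zero  , x≡w₀ = ⊥-elim (ℚ.<-irrefl (trans v₀≡w₀ (trans (sym x≡w₀) x≡)) (inc zero (suc i) ℕ.z<s))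
... | suc j , x≡wⱼ = j , x≡wⱼ

increasing-image-injective : {v w : Fin n → ℚ} → Increasing v → Increasing w →
                             image v ≐ image w → ∀ i → v i ≡ w i
increasing-image-injective {ℕ.zero} _ _ _ ()
increasing-image-injective {suc n} {v} {w} incv incw v≐w = λ where
    zero    → heads
    (suc i) → increasing-image-injective (increasing-tail incv) (increasing-tail incw) tails i
  where
  heads : v zero ≡ w zero
  heads = ℚ.≤-antisym (head-≤-of-⊆ incv (≐⇒⊇ v≐w)) (head-≤-of-⊆ incw (≐⇒⊆ v≐w))
  tails : image (v ∘ suc) ≐ image (w ∘ suc)
  tails _ = mk⇔ (tail-⊆ incv heads (≐⇒⊆ v≐w)) (tail-⊆ incw (sym heads) (≐⇒⊇ v≐w))

imageWithout≐image-punchIn : ∀ (v : Fin (suc n) → ℚ) i → imageWithout v i ≐ image (v ∘ punchIn i)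
imageWithout≐image-punchIn v i x = mk⇔
  (λ (l , l≢i , x≡) → punchOut (l≢i ∘ sym) , trans x≡ (cong v (sym (Fin.punchIn-punchOut _))))
  (λ (j , x≡) → punchIn i j , Fin.punchInᵢ≢i i j , x≡)

affImg-image : ∀ a b (v : Fin n → ℚ) → affImg a b (image v) ≐ image (λ l → a * v l + b)
affImg-image a b v x = mk⇔
  (λ (y , (l , y≡) , x≡) → l , trans x≡ (cong (λ t → a * t + b) y≡))
  (λ (l , x≡) → v l , (l , refl) , x≡)

neg-as-affine : ∀ y → - y ≡ - 1ℚ * y + 0ℚ
neg-as-affine = solve 1 (λ y → :- y := :- con 1ℚ :* y :+ con 0ℚ) refl

mirror-opposite : ∀ (v : Fin n → ℚ) l → mirror v (opposite l) ≡ - 1ℚ * v l + 0ℚ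
mirror-opposite v l = trans (cong (λ k → - v k) (Fin.opposite-involutive l)) (neg-as-affine (v l))

image-mirror : ∀ (v : Fin n → ℚ) → image (mirror v) ≐ neg (image v)
image-mirror v x = mk⇔
  (λ (l , x≡) → v (opposite l) , (opposite l , refl) , trans x≡ (neg-as-affine _))
  (λ { (_ , (l , refl) , x≡) → opposite l , trans x≡ (sym (mirror-opposite v l)) })

imageWithout-mirror : ∀ (v : Fin n → ℚ) i → imageWithout (mirror v) i ≐ neg (imageWithout v (opposite i))
imageWithout-mirror v i x = mk⇔
  (λ (l , l≢i , x≡) → v (opposite l) ,
    (opposite l , l≢i ∘ opposite-injective , refl) , trans x≡ (neg-as-affine _))
  (λ { (_ , (l , l≢ , refl) , x≡) → opposite l ,
    l≢ ∘ trans (sym (Fin.opposite-involutive l)) ∘ cong opposite ,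
    trans x≡ (sym (mirror-opposite v l)) })
  where
  opposite-injective : ∀ {j k : Fin _} → opposite j ≡ opposite k → j ≡ k
  opposite-injective {j} {k} eq =
    trans (sym (Fin.opposite-involutive j)) (trans (cong opposite eq) (Fin.opposite-involutive k))

copy⇒affine-relation : ∀ {a b} {v : Fin (suc n) → ℚ} {i j} → Increasing v → 0ℚ < a →
                       imageWithout v i ≐ affImg a b (imageWithout v j) →
                       ∀ l → v (punchIn i l) ≡ a * v (punchIn j l) + b
copy⇒affine-relation {a = a} {b} {v} {i} {j} inc 0<a v∖i≐ =
  increasing-image-injective (increasing-punchIn inc i)
    (increasing-affine 0<a (increasing-punchIn inc j)) (begin
      image (v ∘ punchIn i)                  ≈⟨ imageWithout≐image-punchIn v i ⟨
      imageWithout v i                       ≈⟨ v∖i≐ ⟩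
      affImg a b (imageWithout v j)          ≈⟨ affImg-cong a b (imageWithout≐image-punchIn v j) ⟩
      affImg a b (image (v ∘ punchIn j))     ≈⟨ affImg-image a b (v ∘ punchIn j) ⟩
      image (λ l → a * v (punchIn j l) + b)  ∎)
  where open ≐-Reasoning

geometric : ∀ (u : Fin (suc n) → ℚ) a → (∀ i → u (suc i) ≡ a * u (inject₁ i)) →
            ∀ j → u j ≡ a ^ toℕ j * u zero
geometric u a rec zero = sym (ℚ.*-identityˡ (u zero))
geometric {suc n} u a rec (suc j) = begin
  u (suc j)                   ≡⟨ geometric (u ∘ suc) a (rec ∘ suc) j ⟩
  a ^ toℕ j * u (suc zero)    ≡⟨ cong (a ^ toℕ j *_) (rec zero) ⟩
  a ^ toℕ j * (a * u zero)    ≡⟨ solve 3 (λ p a u → p :* (a :* u) := a :* p :* u) refl (a ^ toℕ j) a (u zero) ⟩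
  a * a ^ toℕ j * u zero      ∎
  where open ≡-Reasoning

image≐affImg-C₂ : ∀ m (v : Fin (suc (suc m)) → ℚ) d k →
                  (∀ j → v (suc j) ≡ d * k ^ toℕ j + v zero) →
                  image v ≐ affImg d (v zero) (C₂ m k)
image≐affImg-C₂ m v d k progression x = mk⇔ to from
  where
  origin : d * 0ℚ + v zero ≡ v zero
  origin = trans (cong (_+ v zero) (ℚ.*-zeroʳ d)) (ℚ.+-identityˡ (v zero))
  to : image v x → affImg d (v zero) (C₂ m k) x
  to (zero  , x≡) = 0ℚ , inj₁ refl , trans x≡ (sym origin)
  to (suc j , x≡) = k ^ toℕ j , inj₂ (toℕ j , ℕ.s≤s⁻¹ (Fin.toℕ<n j) , refl) , trans x≡ (progression j)
  from : affImg d (v zero) (C₂ m k) x → image v x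
  from (y , inj₁ y≡0 , x≡) = zero , trans x≡ (trans (cong (λ t → d * t + v zero) y≡0) origin)
  from (y , inj₂ (e , e≤m , y≡) , x≡) = suc j , (begin
    x                          ≡⟨ x≡ ⟩
    d * y + v zero             ≡⟨ cong (λ t → d * t + v zero) y≡ ⟩
    d * k ^ e + v zero         ≡⟨ cong (λ t → d * k ^ t + v zero) (Fin.toℕ-fromℕ< e<) ⟨
    d * k ^ toℕ j + v zero     ≡⟨ progression j ⟨
    v (suc j)                  ∎)
    where
    open ≡-Reasoning
    e< : e ℕ.< suc m
    e< = ℕ.s≤s e≤m
    j : Fin (suc m)
    j = fromℕ< e<

p<q⇒0<q-p : ∀ {p q} → p < q → 0ℚ < q - p
p<q⇒0<q-p {p} {q} p<q = subst (_< q - p) (ℚ.+-inverseʳ p) (ℚ.+-monoˡ-< (- p) p<q)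

fixed-point-gaps : ∀ (v : Fin (suc (suc n)) → ℚ) a b → v zero ≡ a * v zero + b →
                   (∀ i → v (suc (suc i)) ≡ a * v (suc (inject₁ i)) + b) →
                   ∀ i → v (suc (suc i)) - v zero ≡ a * (v (suc (inject₁ i)) - v zero)
fixed-point-gaps v a b fixed step i = begin
  v (suc (suc i)) - v zero                          ≡⟨ cong₂ _-_ (step i) fixed ⟩
  (a * v (suc (inject₁ i)) + b) - (a * v zero + b)  ≡⟨ cancel a b (v (suc (inject₁ i))) (v zero) ⟩
  a * (v (suc (inject₁ i)) - v zero)                ∎
  where
  open ≡-Reasoning
  cancel : ∀ a b x y → (a * x + b) - (a * y + b) ≡ a * (x - y)
  cancel = solve 4 (λ a b x y → (a :* x :+ b) :- (a :* y :+ b) := a :* (x :- y)) refl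

copy-of-C₂ : ∀ m (v : Fin (suc (suc (suc m))) → ℚ) → Increasing v →
             IsCopy (imageWithout v (suc zero)) (imageWithout v (fromℕ (suc (suc m)))) →
             Σ ℚ λ k → (1ℚ < k) × IsCopy (C₂ (suc m) k) (image v)
copy-of-C₂ m v inc (a , b , 0<a , v∖1≐) =
  a , 1<a , IsCopy-sym (d , v zero , 0<d , image≐affImg-C₂ (suc m) v d a progression)
  where
  affine : ∀ l → v (punchIn (suc zero) l) ≡ a * v (punchIn (fromℕ (suc (suc m))) l) + b
  affine = copy⇒affine-relation inc 0<a v∖1≐
  gap : Fin (suc (suc m)) → ℚ
  gap j = v (suc j) - v zero
  d : ℚ
  d = gap zero
  gap-rec : ∀ i → gap (suc i) ≡ a * gap (inject₁ i)
  gap-rec = fixed-point-gaps v a b (affine zero)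
    (λ i → trans (affine (suc i)) (cong (λ l → a * v (suc l) + b) (punchIn-fromℕ i)))
  progression : ∀ j → v (suc j) ≡ d * a ^ toℕ j + v zero
  progression j = begin
    v (suc j)                  ≡⟨ solve 2 (λ x y → x := (x :- y) :+ y) refl (v (suc j)) (v zero) ⟩
    gap j + v zero             ≡⟨ cong (_+ v zero) (geometric gap a gap-rec j) ⟩
    a ^ toℕ j * d + v zero     ≡⟨ cong (_+ v zero) (ℚ.*-comm (a ^ toℕ j) d) ⟩
    d * a ^ toℕ j + v zero     ∎
    where open ≡-Reasoning
  0<d : 0ℚ < d
  0<d = p<q⇒0<q-p (inc zero (suc zero) ℕ.z<s)
  1<a : 1ℚ < a
  1<a = ℚ.*-cancelʳ-<-nonNeg d {{ℚ.pos⇒nonNeg d {{positive 0<d}}}}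
    (subst₂ _<_ (sym (ℚ.*-identityˡ d)) (gap-rec zero)
      (ℚ.+-monoˡ-< (- v zero) (inc (suc zero) (suc (suc zero)) (ℕ.s<s ℕ.z<s))))

reflection-of-C₂ : ∀ m (v : Fin (suc (suc (suc m))) → ℚ) → Increasing v →
                   IsCopy (imageWithout v zero) (imageWithout v (inject₁ (fromℕ (suc m)))) →
                   Σ ℚ λ k → (1ℚ < k) × IsReflection (C₂ (suc m) k) (image v)
reflection-of-C₂ m v inc v∖0≅ = reflect (copy-of-C₂ m (mirror v) (increasing-mirror inc) mirrored)
  where
  last : Fin (suc (suc (suc m)))
  last = fromℕ (suc (suc m))
  mirror-last : imageWithout (mirror v) last ≐ neg (imageWithout v zero)
  mirror-last = subst (λ i → imageWithout (mirror v) last ≐ neg (imageWithout v i))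
    (Fin.opposite-involutive zero) (imageWithout-mirror v last)
  mirrored : IsCopy (imageWithout (mirror v) (suc zero)) (imageWithout (mirror v) last)
  mirrored = IsCopy-cong {A = neg (imageWithout v (inject₁ (fromℕ (suc m))))} {B = neg (imageWithout v zero)}
    (≐-sym (imageWithout-mirror v (suc zero))) (≐-sym mirror-last) (IsCopy-neg (IsCopy-sym v∖0≅))
  reflect : (Σ ℚ λ k → (1ℚ < k) × IsCopy (C₂ (suc m) k) (image (mirror v))) →
            Σ ℚ λ k → (1ℚ < k) × IsReflection (C₂ (suc m) k) (image v)
  reflect (k , 1<k , C₂≅mirror) =
    k , 1<k , IsCopy-neg⇒IsReflection (IsCopy-cong ≐-refl (image-mirror v) C₂≅mirror)

lemma3p8 : (m : ℕ) → (s : Fin (suc (suc m)) → ℕ) → StrictlyIncreasing s →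
    (HasSymType s (suc zero) (fromℕ (suc m)) →
      Σ ℚ λ k → (1ℚ < k) × IsCopy (C₂ m k) (setOf s))
    × (HasSymType s zero (inject₁ (fromℕ m)) →
      Σ ℚ λ k → (1ℚ < k) × IsReflection (C₂ m k) (setOf s))
lemma3p8 ℕ.zero  s _   = (λ { (ℕ.s<s () , _) }) , (λ { (() , _) })
lemma3p8 (suc m) s inc =
  (λ (_ , symmetry) → copy-of-C₂ m v v-increasing symmetry) ,
  (λ (_ , symmetry) → reflection-of-C₂ m v v-increasing symmetry)
  where
  v : Fin (suc (suc (suc m))) → ℚ
  v l = ℕ→ℚ (s l)
  v-increasing : Increasing v
  v-increasing i j i<j = ℕ→ℚ-mono-< (inc i j i<j)
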